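{- Let $H\leq\mathrm{Sym}(\Omega)$ be a semiregular subgroup and let $\mathfrak{C}=(\Omega,C)$ be the coherent configuration whose basic relations are the $2$-orbits of $H$. Let $\Omega_1$ be an $H$-orbit and $k$ the number of $H$-orbits on $\Omega$. Then (a) $\mathfrak{C}$ is combinatorially isomorphic to $\mathsf{Inv}(\Omega_1,H)\otimes\mathfrak{D}_k$; (b) $\mathsf{JAut}(\mathfrak{C})=\mathsf{TAut}(\mathfrak{C})$.
   Context: $\Omega$ is a finite set. A subgroup is semiregular if all point stabilizers are trivial. A coherent configuration $(X,R)$ is a partition $R$ of $X\times X$ into nonempty relations such that the diagonal is a union of members of $R$, $R$ is closed under transposition, and the complex span $\mathbb{C}[R]$ of the $0/1$ adjacency matrices $\underline{r}$, $r\in R$, is closed under matrix multiplication. $\mathsf{Inv}(\Omega_1,H)$ is the coherent configuration on $\Omega_1$ whose basic relations are the $2$-orbits of $H$ acting on $\Omega_1$. $\mathfrak{D}_k$ is the discrete configuration on $[k]=\{1,\dots,k\}$ (basic relations $\{(i,j)\}$). The tensor product $(X,R)\otimes(Y,T)$ is the configuration on $X\times Y$ with basic relations $\{((x,y),(x',y')):(x,x')\in r,(y,y')\in t\}$, $r\in R,t\in T$. Two configurations $(X,R),(X',R')$ are combinatorially isomorphic if some bijection $f:X\to X'$ maps $R$ onto $R'$. $\mathsf{JAut}(\mathfrak{C})$ is the group of permutations $\phi$ of $C$ whose linear extension $\underline{c}\mapsto\underline{\phi(c)}$ is an automorphism of the Jordan algebra $(\mathbb{C}[C],\star)$, $X\star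 Y=\tfrac12(XY+YX)$. $\mathsf{TAut}(\mathfrak{C})$ is the group of permutations of $C$ whose linear extension is an automorphism or an anti-automorphism of the algebra $(\mathbb{C}[C],\cdot)$. -}

module Defs where

open import Data.Nat using (ℕ; zero; suc; _+_; _*_)
open import Data.Fin using (Fin; zero; suc; _≟_)
open import Data.Fin.Permutation using (Permutation′; _⟨$⟩ʳ_; id; flip; _∘ₚ_)
open import Data.Product using (Σ; ∃; _×_; _,_)
open import Data.Sum using (_⊎_)
open import Data.Bool using (if_then_else_)
open import Relation.Nullary.Decidable using (does)
open import Relation.Binary.PropositionalEquality using (_≡_)
open import Function.Bundles using (_↔_; Inverse)

record IsSubgroup {n : ℕ} (H : Permutation′ n → Set) : Set where
  field
    has-id  : H id
    closed∘ : ∀ {π σ} → H π → H σ → H (π ∘ₚ σ)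
    closed⁻ : ∀ {π} → H π → H (flip π)

Semiregular : {n : ℕ} → (Permutation′ n → Set) → Set
Semiregular {n} H = ∀ h → H h → ∀ (x : Fin n) → h ⟨$⟩ʳ x ≡ x → ∀ y → h ⟨$⟩ʳ y ≡ y

-- Configurations presented by colourings.
-- A partition R of X × X indexed by a colour type Col is given by a
-- surjective map col : X → X → Col; the basic relations are the fibres.

Surjective₂ : {X Col : Set} → (X → X → Col) → Set
Surjective₂ {X} {Col} col = ∀ (c : Col) → Σ X λ x → Σ X λ y → col x y ≡ c

-- Combinatorial isomorphism: a bijection f : X → X' mapping the set of
-- basic relations onto the set of basic relations (σ records the
-- induced bijection between the relation indices).
CombIso : {X Col X' Col' : Set} → (X → X → Col) → (X' → X' → Col') → Set
CombIso {X} {Col} {X'} {Col'} col col' =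
  Σ (X ↔ X') λ f → Σ (Col ↔ Col') λ σ →
    ∀ x y → col' (Inverse.to f x) (Inverse.to f y) ≡ Inverse.to σ (col x y)

_⊗_ : {X Col Y Col' : Set} → (X → X → Col) → (Y → Y → Col') →
      (X × Y) → (X × Y) → (Col × Col')
(col ⊗ col') (x , y) (x' , y') = col x x' , col' y y'

discrete : (k : ℕ) → Fin k → Fin k → Fin k × Fin k
discrete k i j = i , j

-- col (with m colours) is the colouring whose basic relations are exactly
-- the 2-orbits of H on Fin n (i.e. col presents Inv(Fin n, H)).
IsTwoOrbitColouring : {n m : ℕ} → (Permutation′ n → Set) → (Fin n → Fin n → Fin m) → Set
IsTwoOrbitColouring {n} H col =
  Surjective₂ col ×
  (∀ x y x' y' → (col x y ≡ col x' y' →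
                    Σ (Permutation′ n) λ h → H h × h ⟨$⟩ʳ x ≡ x' × h ⟨$⟩ʳ y ≡ y')
               × (Σ (Permutation′ n) (λ h → H h × h ⟨$⟩ʳ x ≡ x' × h ⟨$⟩ʳ y ≡ y') →
                    col x y ≡ col x' y'))

IsOrbitEmbedding : {n n₁ : ℕ} → (Permutation′ n → Set) → (Fin n₁ → Fin n) → Set
IsOrbitEmbedding {n} {n₁} H ι =
  (∀ a b → ι a ≡ ι b → a ≡ b) ×
  Σ (Fin n) λ x₀ → ∀ y →
    (Σ (Fin n₁) (λ a → ι a ≡ y) → Σ (Permutation′ n) λ h → H h × h ⟨$⟩ʳ x₀ ≡ y) ×
    (Σ (Permutation′ n) (λ h → H h × h ⟨$⟩ʳ x₀ ≡ y) → Σ (Fin n₁) λ a → ι a ≡ y)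

-- col₁ presents Inv(Ω₁, H), where Ω₁ ≅ Fin n₁ via ι: basic relations are
-- the 2-orbits of H acting on Ω₁.
IsTwoOrbitColouringOn : {n n₁ m₁ : ℕ} → (Permutation′ n → Set) → (Fin n₁ → Fin n) →
                        (Fin n₁ → Fin n₁ → Fin m₁) → Set
IsTwoOrbitColouringOn {n} H ι col₁ =
  Surjective₂ col₁ ×
  (∀ a b a' b' → (col₁ a b ≡ col₁ a' b' →
                    Σ (Permutation′ n) λ h → H h × h ⟨$⟩ʳ ι a ≡ ι a' × h ⟨$⟩ʳ ι b ≡ ι b')
               × (Σ (Permutation′ n) (λ h → H h × h ⟨$⟩ʳ ι a ≡ ι a' × h ⟨$⟩ʳ ι b ≡ ι b') →
                    col₁ a b ≡ col₁ a' b'))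

-- orb : Fin n → Fin k is a surjection whose fibres are exactly the
-- H-orbits; hence k is the number of H-orbits.
IsOrbitCount : {n k : ℕ} → (Permutation′ n → Set) → (Fin n → Fin k) → Set
IsOrbitCount {n} {k} H orb =
  (∀ (i : Fin k) → Σ (Fin n) λ x → orb x ≡ i) ×
  (∀ x y → (orb x ≡ orb y → Σ (Permutation′ n) λ h → H h × h ⟨$⟩ʳ x ≡ y) ×
           (Σ (Permutation′ n) (λ h → H h × h ⟨$⟩ʳ x ≡ y) → orb x ≡ orb y))

-- Matrices are Fin n → Fin n → ℕ; since the
-- adjacency matrices are 0/1 and form a basis of ℂ[C] whose structure
-- constants are natural numbers, equalities in ℂ[C] between
-- ℕ-combinations of products of basis matrices can be checked over ℕ.

Mat : ℕ → Set
Mat n = Fin n → Fin n → ℕ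

∑ : {n : ℕ} → (Fin n → ℕ) → ℕ
∑ {zero}  f = 0
∑ {suc n} f = f zero + ∑ (λ i → f (suc i))

_·_ : {n : ℕ} → Mat n → Mat n → Mat n
(A · B) x y = ∑ λ z → A x z * B z y

_⊕_ : {n : ℕ} → Mat n → Mat n → Mat n
(A ⊕ B) x y = A x y + B x y

_≐_ : {n : ℕ} → Mat n → Mat n → Set
A ≐ B = ∀ x y → A x y ≡ B x y

adj : {n m : ℕ} → (Fin n → Fin n → Fin m) → Fin m → Mat n
adj col c x y = if does (col x y ≟ c) then 1 else 0

lincomb : {n m : ℕ} → (Fin m → ℕ) → (Fin m → Mat n) → Mat n
lincomb λc M x y = ∑ λ c → λc c * M c x y

-- The linear extension of φ (a permutation of the basic relations) is an
-- algebra automorphism of (ℂ[C], ·): it preserves products of basis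
-- elements, i.e. whenever A_a A_b = Σ λ_c A_c then
-- A_{φa} A_{φb} = Σ λ_c A_{φc}.
IsAlgAut : {n m : ℕ} → (Fin n → Fin n → Fin m) → Permutation′ m → Set
IsAlgAut {n} {m} col φ = ∀ a b (λc : Fin m → ℕ) →
  (adj col a · adj col b) ≐ lincomb λc (adj col) →
  (adj col (φ ⟨$⟩ʳ a) · adj col (φ ⟨$⟩ʳ b)) ≐ lincomb λc (λ c → adj col (φ ⟨$⟩ʳ c))

IsAlgAntiAut : {n m : ℕ} → (Fin n → Fin n → Fin m) → Permutation′ m → Set
IsAlgAntiAut {n} {m} col φ = ∀ a b (λc : Fin m → ℕ) →
  (adj col a · adj col b) ≐ lincomb λc (adj col) →
  (adj col (φ ⟨$⟩ʳ b) · adj col (φ ⟨$⟩ʳ a)) ≐ lincomb λc (λ c → adj col (φ ⟨$⟩ʳ c))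

-- Jordan automorphism: L(X ⋆ Y) = L(X) ⋆ L(Y) with X ⋆ Y = (XY+YX)/2;
-- the common factor 1/2 is cleared.
IsJordanAut : {n m : ℕ} → (Fin n → Fin n → Fin m) → Permutation′ m → Set
IsJordanAut {n} {m} col φ = ∀ a b (λc : Fin m → ℕ) →
  ((adj col a · adj col b) ⊕ (adj col b · adj col a)) ≐ lincomb λc (adj col) →
  ((adj col (φ ⟨$⟩ʳ a) · adj col (φ ⟨$⟩ʳ b)) ⊕ (adj col (φ ⟨$⟩ʳ b) · adj col (φ ⟨$⟩ʳ a)))
    ≐ lincomb λc (λ c → adj col (φ ⟨$⟩ʳ c))

InJAut : {n m : ℕ} → (Fin n → Fin n → Fin m) → Permutation′ m → Set
InJAut = IsJordanAut

InTAut : {n m : ℕ} → (Fin n → Fin n → Fin m) → Permutation′ m → Set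
InTAut col φ = IsAlgAut col φ ⊎ IsAlgAntiAut col φ

-- (a) Fix x₀ ∈ Ω₁ and a representative of each H-orbit. By semiregularity every point x is the image
-- of the representative of its orbit under a unique g x ∈ H, and x ↦ (g x x₀, orbit of x) is a bijection
-- Ω → Ω₁ × [k] satisfying g (h x) x₀ = h (g x x₀). Hence two pairs lie in the same 2-orbit of H iff
-- their images do, which is the combinatorial isomorphism.
--
-- (b) Again by semiregularity, a point x and a basic relation a determine at most one z with (x, z) ∈ a,
-- so A_a A_b is A_c or 0 according as some triangle has sides a, b, c: the basic relations form a
-- connected groupoid and ℂ[C] is its groupoid algebra. A permutation of C is thus an (anti-)automorphism
-- iff it is an (anti-)functor, and a Jordan automorphism iff it preserves the multisets {a b, b a}.
-- Such a map sends identities to identities and either keeps or swaps the ends of each non-loop;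
-- composable non-loops behave alike, so by connectedness the map, or its composite with inversion,
-- keeps all ends and is then a functor. If every arrow is a loop the groupoid is a group; there the
-- Jordan triple identity gives F (x y x) = F x F y F x, which forces F to be a homomorphism or an
-- anti-homomorphism.
module Submission where

open import Defs
open import Data.Nat using (ℕ; zero; suc; _+_; _*_)
open import Data.Nat.Properties
  using (+-comm; +-identityʳ; +-cancelˡ-≡; +-cancelʳ-≡; *-identityˡ; *-identityʳ; *-zeroʳ; *-cancelˡ-≡)
open import Data.Nat.Solver using (module +-*-Solver)
open import Data.Fin using (Fin; zero; suc; _≟_)
open import Data.Fin.Properties using (any?; all?; ¬∀⟶∃¬)
open import Data.Fin.Permutation using (Permutation′; _⟨$⟩ʳ_; _⟨$⟩ˡ_; flip; _∘ₚ_; inverseˡ; inverseʳ)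
open import Data.Bool using (if_then_else_)
open import Data.Product using (Σ; ∃; _×_; _,_; proj₁; proj₂)
import Data.Product as Product
open import Data.Product.Properties using (,-injective)
open import Data.Sum using (_⊎_; inj₁; inj₂; [_,_]′)
import Data.Sum as Sum
open import Data.Empty using (⊥; ⊥-elim)
open import Relation.Nullary using (Dec; yes; no; ¬_)
open import Relation.Nullary.Decidable using (does; _×-dec_; ¬?; decidable-stable)
open import Relation.Unary using (Pred; Decidable)
open import Relation.Binary.PropositionalEquality
open import Function using (_∘_; id)
open import Function.Bundles using (_↔_; _⇔_; Inverse; Injection; Equivalence; mk↔ₛ′; mk⇔)
open import Function.Properties.Inverse using (↔⇒↣)
open import Level using (0ℓ)
open import Algebra.Bundles using (Group)
open import Algebra.Structures using (IsGroup)
import Algebra.Properties.Group as GroupProperties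

-- adj col c x y is definitionally χ (col x y ≟ c).
χ : {A : Set} → Dec A → ℕ
χ A? = if does A? then 1 else 0

δ : {m : ℕ} → Fin m → Fin m → ℕ
δ a b = χ (a ≟ b)

-- The multiset {p, q} as a multiplicity function.
⟅_,_⟆ : {m : ℕ} → Fin m → Fin m → Fin m → ℕ
⟅ p , q ⟆ d = δ d p + δ d q

module _ {A B : Set} where

  χ-cong : (A → B) → (B → A) → (A? : Dec A) (B? : Dec B) → χ A? ≡ χ B?
  χ-cong f g (yes _) (yes _) = refl
  χ-cong f g (no _)  (no _)  = refl
  χ-cong f g (yes a) (no ¬b) = ⊥-elim (¬b (f a))
  χ-cong f g (no ¬a) (yes b) = ⊥-elim (¬a (g b))

  χ-≡⇒ : (A? : Dec A) (B? : Dec B) → χ A? ≡ χ B? → A → B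
  χ-≡⇒ A?      (yes b) eq a = b
  χ-≡⇒ (yes _) (no _)  () a
  χ-≡⇒ (no ¬a) (no _)  eq a = ⊥-elim (¬a a)

  χ-× : (A? : Dec A) (B? : Dec B) → χ A? * χ B? ≡ χ (A? ×-dec B?)
  χ-× (yes _) (yes _) = refl
  χ-× (yes _) (no _)  = refl
  χ-× (no _)  _       = refl

χ-no : {A : Set} → ¬ A → (A? : Dec A) → χ A? ≡ 0
χ-no ¬a (yes a) = ⊥-elim (¬a a)
χ-no ¬a (no _)  = refl

module _ {A B C D : Set} where

  χ+χ-any : (A? : Dec A) (B? : Dec B) (C? : Dec C) (D? : Dec D) → χ A? + χ B? ≡ χ C? + χ D? → A → C ⊎ D
  χ+χ-any _       _ (yes c) _       eq a = inj₁ c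
  χ+χ-any _       _ (no _)  (yes d) eq a = inj₂ d
  χ+χ-any (yes _) _ (no _)  (no _)  () a
  χ+χ-any (no ¬a) _ (no _)  (no _)  eq a = ⊥-elim (¬a a)

  χ+χ-both : (A? : Dec A) (B? : Dec B) (C? : Dec C) (D? : Dec D) → χ A? + χ B? ≡ χ C? + χ D? → A → B → C × D
  χ+χ-both _       _       (yes c) (yes d) eq a b = c , d
  χ+χ-both (no ¬a) _       _       _       eq a b = ⊥-elim (¬a a)
  χ+χ-both (yes _) (no ¬b) _       _       eq a b = ⊥-elim (¬b b)
  χ+χ-both (yes _) (yes _) (no _)  (yes _) () a b
  χ+χ-both (yes _) (yes _) (no _)  (no _)  () a b
  χ+χ-both (yes _) (yes _) (yes _) (no _)  () a b

δ-injective : {m : ℕ} {p q : Fin m} → (∀ d → δ d p ≡ δ d q) → p ≡ q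
δ-injective {p = p} {q} eq = χ-≡⇒ (p ≟ p) (p ≟ q) (eq p) refl

δ-permute : {m : ℕ} (φ : Permutation′ m) (d c : Fin m) → δ d (φ ⟨$⟩ʳ c) ≡ δ (φ ⟨$⟩ˡ d) c
δ-permute φ d c =
  χ-cong (λ e → trans (cong (φ ⟨$⟩ˡ_) e) (inverseˡ φ)) (λ e → trans (sym (inverseʳ φ)) (cong (φ ⟨$⟩ʳ_) e))
         (d ≟ φ ⟨$⟩ʳ c) (φ ⟨$⟩ˡ d ≟ c)

⟅⟆-injective : {m : ℕ} {p q r s : Fin m} → (∀ d → ⟅ p , q ⟆ d ≡ ⟅ r , s ⟆ d) →
               (p ≡ r × q ≡ s) ⊎ (p ≡ s × q ≡ r)
⟅⟆-injective {p = p} {q} {r} {s} eq with χ+χ-any (p ≟ p) (p ≟ q) (p ≟ r) (p ≟ s) (eq p) refl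
... | inj₁ p≡r = inj₁ (p≡r , δ-injective λ d →
        +-cancelˡ-≡ (δ d p) _ _ (trans (eq d) (cong (λ u → δ d u + δ d s) (sym p≡r))))
... | inj₂ p≡s = inj₂ (p≡s , δ-injective λ d →
        +-cancelˡ-≡ (δ d p) _ _
          (trans (eq d) (trans (+-comm (δ d r) (δ d s)) (cong (λ u → δ d u + δ d r) (sym p≡s)))))

∑-cong : {n : ℕ} {f g : Fin n → ℕ} → (∀ i → f i ≡ g i) → ∑ f ≡ ∑ g
∑-cong {zero}  eq = refl
∑-cong {suc n} eq = cong₂ _+_ (eq zero) (∑-cong (λ i → eq (suc i)))

∑-zero : {n : ℕ} {f : Fin n → ℕ} → (∀ i → f i ≡ 0) → ∑ f ≡ 0
∑-zero {zero}  eq = refl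
∑-zero {suc n} eq = cong₂ _+_ (eq zero) (∑-zero (λ i → eq (suc i)))

∑-select : {n : ℕ} (f : Fin n → ℕ) (d : Fin n) → ∑ (λ c → f c * δ d c) ≡ f d
∑-select {suc n} f zero =
  trans (cong₂ _+_ (*-identityʳ (f zero)) (∑-zero (λ i → *-zeroʳ (f (suc i))))) (+-identityʳ (f zero))
∑-select {suc n} f (suc d) = cong₂ _+_ (*-zeroʳ (f zero)) (∑-select (λ c → f (suc c)) d)

∑-χ-unique : {n : ℕ} {P : Pred (Fin n) _} (P? : Decidable P) → (∀ {z z′} → P z → P z′ → z ≡ z′) →
             ∑ (λ z → χ (P? z)) ≡ χ (any? P?)
∑-χ-unique {P = P} P? unique with any? P?
... | yes (z₀ , p₀) = trans (∑-cong (λ z → trans (indicator z) (sym (*-identityˡ _)))) (∑-select (λ _ → 1) z₀)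
  where
    indicator : ∀ z → χ (P? z) ≡ δ z₀ z
    indicator z = χ-cong (unique p₀) (λ e → subst P e p₀) (P? z) (z₀ ≟ z)
... | no ¬∃ = ∑-zero (λ z → χ-no (λ p → ¬∃ (z , p)) (P? z))

module _ {X Col X′ Col′ : Set} {col : X → X → Col} {col′ : X′ → X′ → Col′} where

  combIso-intro : Surjective₂ col → Surjective₂ col′ → (f : X ↔ X′) →
                  (∀ x y x′ y′ → col x y ≡ col x′ y′ ⇔
                     col′ (Inverse.to f x) (Inverse.to f y) ≡ col′ (Inverse.to f x′) (Inverse.to f y′)) →
                  CombIso col col′
  combIso-intro surj surj′ f same = f , mk↔ₛ′ σ τ στ τσ , σ-col
    where
      open Inverse f using (to; from; strictlyInverseˡ)
      σ : Col → Col′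
      σ c = let (x , y , _) = surj c in col′ (to x) (to y)
      τ : Col′ → Col
      τ c′ = let (x′ , y′ , _) = surj′ c′ in col (from x′) (from y′)
      σ-col : ∀ x y → col′ (to x) (to y) ≡ σ (col x y)
      σ-col x y = let (x₁ , y₁ , e) = surj (col x y) in Equivalence.to (same x y x₁ y₁) (sym e)
      στ : ∀ c′ → σ (τ c′) ≡ c′
      στ c′ = let (x′ , y′ , e) = surj′ c′ in
        trans (sym (σ-col (from x′) (from y′)))
              (trans (cong₂ col′ (strictlyInverseˡ x′) (strictlyInverseˡ y′)) e)
      τσ : ∀ c → τ (σ c) ≡ c
      τσ c = let (x , y , e) = surj c ; (x′ , y′ , e′) = surj′ (σ c) in
        trans (Equivalence.from (same (from x′) (from y′) x y)
                 (trans (cong₂ col′ (strictlyInverseˡ x′) (strictlyInverseˡ y′)) e′))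
              e

⊗-surjective : {X Col Y Col′ : Set} {col : X → X → Col} {col′ : Y → Y → Col′} →
               Surjective₂ col → Surjective₂ col′ → Surjective₂ (col ⊗ col′)
⊗-surjective surj surj′ (c , c′) =
  let (x , x′ , e) = surj c ; (y , y′ , e′) = surj′ c′ in (x , y) , (x′ , y′) , cong₂ _,_ e e′

discrete-surjective : (k : ℕ) → Surjective₂ (discrete k)
discrete-surjective k (i , j) = i , j , refl

module Coefficients {n m : ℕ} (col : Fin n → Fin n → Fin m) (surj : Surjective₂ col) where

  Transports : Permutation′ m → (Fin m → Fin m → Mat n) → (Fin m → Fin m → Mat n) → Set
  Transports φ M M′ = ∀ a b (λc : Fin m → ℕ) →
    M a b ≐ lincomb λc (adj col) → M′ a b ≐ lincomb λc (λ c → adj col (φ ⟨$⟩ʳ c))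

  HasCoefficients : (Fin m → Fin m → Mat n) → (Fin m → Fin m → Fin m → ℕ) → Set
  HasCoefficients M K = ∀ a b x y → M a b x y ≡ K a b (col x y)

  lincomb-adj : ∀ λc x y → lincomb λc (adj col) x y ≡ λc (col x y)
  lincomb-adj λc x y = ∑-select λc (col x y)

  lincomb-adj-permuted : ∀ (φ : Permutation′ m) λc x y →
                         lincomb λc (λ c → adj col (φ ⟨$⟩ʳ c)) x y ≡ λc (φ ⟨$⟩ˡ col x y)
  lincomb-adj-permuted φ λc x y =
    trans (∑-cong (λ c → cong (λc c *_) (δ-permute φ (col x y) c))) (∑-select λc (φ ⟨$⟩ˡ col x y))

  transports⇔ : ∀ {M M′ : Fin m → Fin m → Mat n} φ K K′ → HasCoefficients M K → HasCoefficients M′ K′ →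
                Transports φ M M′ ⇔ (∀ a b c → K a b c ≡ K′ a b (φ ⟨$⟩ʳ c))
  transports⇔ {M} {M′} φ K K′ M-K M′-K′ = mk⇔ forth back
    where
      forth : Transports φ M M′ → ∀ a b c → K a b c ≡ K′ a b (φ ⟨$⟩ʳ c)
      forth T a b c = let (x , y , xy) = surj (φ ⟨$⟩ʳ c) in begin
        K a b c                                        ≡⟨ cong (K a b) (inverseˡ φ) ⟨
        K a b (φ ⟨$⟩ˡ (φ ⟨$⟩ʳ c))                      ≡⟨ cong (λ d → K a b (φ ⟨$⟩ˡ d)) xy ⟨
        K a b (φ ⟨$⟩ˡ col x y)                         ≡⟨ lincomb-adj-permuted φ (K a b) x y ⟨
        lincomb (K a b) (λ d → adj col (φ ⟨$⟩ʳ d)) x y ≡⟨ T a b (K a b) expansion x y ⟨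
        M′ a b x y                                     ≡⟨ M′-K′ a b x y ⟩
        K′ a b (col x y)                               ≡⟨ cong (K′ a b) xy ⟩
        K′ a b (φ ⟨$⟩ʳ c)                              ∎
        where
          open ≡-Reasoning
          expansion : M a b ≐ lincomb (K a b) (adj col)
          expansion x y = trans (M-K a b x y) (sym (lincomb-adj (K a b) x y))
      back : (∀ a b c → K a b c ≡ K′ a b (φ ⟨$⟩ʳ c)) → Transports φ M M′
      back N a b λc M≐ x y = begin
        M′ a b x y                                     ≡⟨ M′-K′ a b x y ⟩
        K′ a b (col x y)                               ≡⟨ cong (K′ a b) (inverseʳ φ) ⟨
        K′ a b (φ ⟨$⟩ʳ (φ ⟨$⟩ˡ col x y))               ≡⟨ N a b _ ⟨
        K a b (φ ⟨$⟩ˡ col x y)                         ≡⟨ coefficient (φ ⟨$⟩ˡ col x y) ⟨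
        λc (φ ⟨$⟩ˡ col x y)                            ≡⟨ lincomb-adj-permuted φ λc x y ⟨
        lincomb λc (λ c → adj col (φ ⟨$⟩ʳ c)) x y       ∎
        where
          open ≡-Reasoning
          coefficient : ∀ c → λc c ≡ K a b c
          coefficient c = let (x , y , xy) = surj c in begin
            λc c                     ≡⟨ cong λc xy ⟨
            λc (col x y)             ≡⟨ lincomb-adj λc x y ⟨
            lincomb λc (adj col) x y ≡⟨ M≐ x y ⟨
            M a b x y                ≡⟨ M-K a b x y ⟩
            K a b (col x y)          ≡⟨ cong (K a b) xy ⟩
            K a b c                  ∎

-- Jordan maps of finite groups

module JordanTripleCount {m : ℕ} (_∙_ : Fin m → Fin m → Fin m)
    (assoc : ∀ x y z → (x ∙ y) ∙ z ≡ x ∙ (y ∙ z)) where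

  -- The weight under c of (x ∘ y) ∘ z in the semigroup algebra, where u ∘ v = uv + vu.
  jordan₂ : (Fin m → ℕ) → Fin m → Fin m → Fin m → ℕ
  jordan₂ c x y z = (c ((x ∙ y) ∙ z) + c (z ∙ (x ∙ y))) + (c ((y ∙ x) ∙ z) + c (z ∙ (y ∙ x)))

  private
    open +-*-Solver using (solve; _:=_; _:+_; _:*_; con)

    rearrange : ∀ A B P₁ P₂ P₃ P₄ →
      ((A + P₁) + (P₂ + B)) + ((P₃ + A) + (B + P₄)) ≡ 2 * (A + B) + ((P₁ + P₃) + (P₄ + P₂))
    rearrange = solve 6 (λ A B P₁ P₂ P₃ P₄ →
      ((A :+ P₁) :+ (P₂ :+ B)) :+ ((P₃ :+ A) :+ (B :+ P₄))
        := con 2 :* (A :+ B) :+ ((P₁ :+ P₃) :+ (P₄ :+ P₂))) refl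

  jordan-triple : ∀ c x y z →
    jordan₂ c x y z + jordan₂ c y z x ≡ 2 * (c ((x ∙ y) ∙ z) + c ((z ∙ y) ∙ x)) + jordan₂ c z x y
  jordan-triple c x y z
    rewrite sym (assoc z x y) | sym (assoc z y x) | sym (assoc x y z)
          | sym (assoc x z y) | sym (assoc y z x) | sym (assoc y x z)
    = rearrange (c ((x ∙ y) ∙ z)) (c ((z ∙ y) ∙ x))
                (c ((z ∙ x) ∙ y)) (c ((y ∙ x) ∙ z)) (c ((y ∙ z) ∙ x)) (c ((x ∙ z) ∙ y))

module JordanGroupMap {m : ℕ} {mul : Fin m → Fin m → Fin m} {unit : Fin m} {inverse : Fin m → Fin m}
    (isGroup : IsGroup _≡_ mul unit inverse) where

  group : Group 0ℓ 0ℓ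
  group = record { isGroup = isGroup }

  open Group group using (_∙_; ε; _⁻¹; assoc; identityˡ; identityʳ) renaming (inverseʳ to ∙-inverseʳ)
  open GroupProperties group
    using ( ∙-cancelˡ; ∙-cancelʳ; inverseˡ-unique; inverseʳ-unique; ⁻¹-anti-homo-∙
          ; \\-leftDividesˡ; //-rightDividesˡ; //-rightDividesʳ)
  open JordanTripleCount _∙_ assoc
  open ≡-Reasoning

  module Map (F : Fin m → Fin m) (F-injective : ∀ {a b} → F a ≡ F b → a ≡ b)
      (jordan : ∀ a b d → ⟅ F (a ∙ b) , F (b ∙ a) ⟆ d ≡ ⟅ F a ∙ F b , F b ∙ F a ⟆ d) where

    IsHom IsAnti Commute : Fin m → Fin m → Set
    IsHom a b = F (a ∙ b) ≡ F a ∙ F b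
    IsAnti a b = F (a ∙ b) ≡ F b ∙ F a
    Commute x y = x ∙ y ≡ y ∙ x

    hom⊎anti-pair : ∀ a b → (IsHom a b × IsHom b a) ⊎ (IsAnti a b × IsAnti b a)
    hom⊎anti-pair a b = ⟅⟆-injective (jordan a b)

    hom-or-anti : ∀ a b → IsHom a b ⊎ IsAnti a b
    hom-or-anti a b = Sum.map proj₁ proj₁ (hom⊎anti-pair a b)

    F-ε : F ε ≡ ε
    F-ε = sym (∙-cancelˡ (F ε) ε (F ε) (trans (identityʳ (F ε)) (trans (cong F (sym (identityˡ ε))) F-εε)))
      where
        F-εε : F (ε ∙ ε) ≡ F ε ∙ F ε
        F-εε = [ id , id ]′ (hom-or-anti ε ε)

    F-⁻¹ : ∀ a → F (a ⁻¹) ≡ F a ⁻¹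
    F-⁻¹ a with hom-or-anti a (a ⁻¹)
    ... | inj₁ h = inverseʳ-unique (F a) (F (a ⁻¹)) (trans (sym h) (trans (cong F (∙-inverseʳ a)) F-ε))
    ... | inj₂ h = inverseˡ-unique (F (a ⁻¹)) (F a) (trans (sym h) (trans (cong F (∙-inverseʳ a)) F-ε))

    jordan₂-image : ∀ d x y z → jordan₂ (λ w → δ d (F w)) x y z ≡ jordan₂ (δ d) (F x) (F y) (F z)
    jordan₂-image d x y z =
      trans (cong₂ _+_ (jordan (x ∙ y) z d) (jordan (y ∙ x) z d)) (by-pair (hom⊎anti-pair x y))
      where
        outer : Fin m → ℕ
        outer u = ⟅ u ∙ F z , F z ∙ u ⟆ d
        by-pair : (IsHom x y × IsHom y x) ⊎ (IsAnti x y × IsAnti y x) →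
                  outer (F (x ∙ y)) + outer (F (y ∙ x)) ≡ jordan₂ (δ d) (F x) (F y) (F z)
        by-pair (inj₁ (hxy , hyx)) = cong₂ _+_ (cong outer hxy) (cong outer hyx)
        by-pair (inj₂ (axy , ayx)) =
          trans (+-comm (outer (F (x ∙ y))) _) (cong₂ _+_ (cong outer ayx) (cong outer axy))

    triple-image : ∀ x y z → F ((x ∙ y) ∙ z) ≡ (F x ∙ F y) ∙ F z ⊎ F ((x ∙ y) ∙ z) ≡ (F z ∙ F y) ∙ F x
    triple-image x y z =
      Sum.map proj₁ proj₁ (⟅⟆-injective {q = F ((z ∙ y) ∙ x)} {s = (F z ∙ F y) ∙ F x}
                             λ d → *-cancelˡ-≡ _ _ 2 (+-cancelʳ-≡ _ _ _ (counts d)))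
      where
        counts : ∀ d → 2 * ⟅ F ((x ∙ y) ∙ z) , F ((z ∙ y) ∙ x) ⟆ d + jordan₂ (δ d) (F z) (F x) (F y)
                     ≡ 2 * ⟅ (F x ∙ F y) ∙ F z , (F z ∙ F y) ∙ F x ⟆ d + jordan₂ (δ d) (F z) (F x) (F y)
        counts d = begin
          2 * ⟅ F ((x ∙ y) ∙ z) , F ((z ∙ y) ∙ x) ⟆ d + jordan₂ (δ d) (F z) (F x) (F y)
            ≡⟨ cong (2 * ⟅ F ((x ∙ y) ∙ z) , F ((z ∙ y) ∙ x) ⟆ d +_) (sym (jordan₂-image d z x y)) ⟩
          2 * ⟅ F ((x ∙ y) ∙ z) , F ((z ∙ y) ∙ x) ⟆ d + jordan₂ δF-d z x y
            ≡⟨ sym (jordan-triple δF-d x y z) ⟩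
          jordan₂ δF-d x y z + jordan₂ δF-d y z x
            ≡⟨ cong₂ _+_ (jordan₂-image d x y z) (jordan₂-image d y z x) ⟩
          jordan₂ (δ d) (F x) (F y) (F z) + jordan₂ (δ d) (F y) (F z) (F x)
            ≡⟨ jordan-triple (δ d) (F x) (F y) (F z) ⟩
          2 * ⟅ (F x ∙ F y) ∙ F z , (F z ∙ F y) ∙ F x ⟆ d + jordan₂ (δ d) (F z) (F x) (F y) ∎
          where
            δF-d : Fin m → ℕ
            δF-d w = δ d (F w)

    sandwich : ∀ x y → F ((x ∙ y) ∙ x) ≡ (F x ∙ F y) ∙ F x
    sandwich x y = [ id , id ]′ (triple-image x y x)

    commute-⁻¹ : ∀ {x y} → x ∙ y ⁻¹ ≡ y ⁻¹ ∙ x → Commute y x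
    commute-⁻¹ {x} {y} h = begin
      y ∙ x                  ≡⟨ //-rightDividesˡ y (y ∙ x) ⟨
      ((y ∙ x) ∙ y ⁻¹) ∙ y   ≡⟨ cong (_∙ y) (assoc y x (y ⁻¹)) ⟩
      (y ∙ (x ∙ y ⁻¹)) ∙ y   ≡⟨ cong (λ u → (y ∙ u) ∙ y) h ⟩
      (y ∙ (y ⁻¹ ∙ x)) ∙ y   ≡⟨ cong (_∙ y) (\\-leftDividesˡ y x) ⟩
      x ∙ y                  ∎

    -- With r = (a b)⁻¹ we have (b r) c = a⁻¹ c, and the sandwich identity gives F (a⁻¹ c) = F c (F a)⁻¹;
    -- the two cases of the triple identity for (b, r, c) make F a commute with F c or with F b.
    hom-anti-commute : ∀ {a b c} → IsHom a b → IsAnti a c → Commute (F a) (F b) ⊎ Commute (F a) (F c)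
    hom-anti-commute {a} {b} {c} hab aac with F a ∙ F c ≟ F c ∙ F a
    ... | yes ac  = inj₂ ac
    ... | no ¬ac = inj₁ (by-triple (triple-image b r c))
      where
        r : Fin m
        r = (a ∙ b) ⁻¹

        F-ca : F (c ∙ a) ≡ F a ∙ F c
        F-ca = [ (λ (hac , _) → ⊥-elim (¬ac (trans (sym hac) aac))) , proj₂ ]′ (hom⊎anti-pair a c)

        F-a⁻¹c : F (a ⁻¹ ∙ c) ≡ F c ∙ F a ⁻¹
        F-a⁻¹c = trans (sym (//-rightDividesʳ (F a) _)) (cong (_∙ F a ⁻¹) (∙-cancelˡ (F a) _ _ (begin
          F a ∙ (F (a ⁻¹ ∙ c) ∙ F a)   ≡⟨ assoc (F a) _ (F a) ⟨
          (F a ∙ F (a ⁻¹ ∙ c)) ∙ F a   ≡⟨ sandwich a (a ⁻¹ ∙ c) ⟨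
          F ((a ∙ (a ⁻¹ ∙ c)) ∙ a)     ≡⟨ cong (λ w → F (w ∙ a)) (\\-leftDividesˡ a c) ⟩
          F (c ∙ a)                    ≡⟨ F-ca ⟩
          F a ∙ F c                    ∎)))

        F-r : F r ≡ F b ⁻¹ ∙ F a ⁻¹
        F-r = trans (F-⁻¹ (a ∙ b)) (trans (cong _⁻¹ hab) (⁻¹-anti-homo-∙ (F a) (F b)))

        br≡a⁻¹ : b ∙ r ≡ a ⁻¹
        br≡a⁻¹ = trans (cong (b ∙_) (⁻¹-anti-homo-∙ a b)) (\\-leftDividesˡ b (a ⁻¹))

        F-brc : F ((b ∙ r) ∙ c) ≡ F c ∙ F a ⁻¹
        F-brc = trans (cong (λ w → F (w ∙ c)) br≡a⁻¹) F-a⁻¹c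

        by-triple : F ((b ∙ r) ∙ c) ≡ (F b ∙ F r) ∙ F c ⊎ F ((b ∙ r) ∙ c) ≡ (F c ∙ F r) ∙ F b →
                    Commute (F a) (F b)
        by-triple (inj₁ t) = ⊥-elim (¬ac (commute-⁻¹ (begin
          F c ∙ F a ⁻¹               ≡⟨ F-brc ⟨
          F ((b ∙ r) ∙ c)            ≡⟨ t ⟩
          (F b ∙ F r) ∙ F c          ≡⟨ cong (λ w → (F b ∙ w) ∙ F c) F-r ⟩
          (F b ∙ (F b ⁻¹ ∙ F a ⁻¹)) ∙ F c ≡⟨ cong (_∙ F c) (\\-leftDividesˡ (F b) (F a ⁻¹)) ⟩
          F a ⁻¹ ∙ F c               ∎)))
        by-triple (inj₂ t) = commute-⁻¹ (begin
          F b ∙ F a ⁻¹                         ≡⟨ cong (F b ∙_) a⁻¹≡b⁻¹a⁻¹b ⟩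
          F b ∙ ((F b ⁻¹ ∙ F a ⁻¹) ∙ F b)      ≡⟨ assoc (F b) _ (F b) ⟨
          (F b ∙ (F b ⁻¹ ∙ F a ⁻¹)) ∙ F b      ≡⟨ cong (_∙ F b) (\\-leftDividesˡ (F b) (F a ⁻¹)) ⟩
          F a ⁻¹ ∙ F b                         ∎)
          where
            a⁻¹≡b⁻¹a⁻¹b : F a ⁻¹ ≡ (F b ⁻¹ ∙ F a ⁻¹) ∙ F b
            a⁻¹≡b⁻¹a⁻¹b = ∙-cancelˡ (F c) _ _ (begin
              F c ∙ F a ⁻¹                     ≡⟨ F-brc ⟨
              F ((b ∙ r) ∙ c)                  ≡⟨ t ⟩
              (F c ∙ F r) ∙ F b                ≡⟨ assoc (F c) (F r) (F b) ⟩
              F c ∙ (F r ∙ F b)                ≡⟨ cong (λ w → F c ∙ (w ∙ F b)) F-r ⟩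
              F c ∙ ((F b ⁻¹ ∙ F a ⁻¹) ∙ F b)  ∎)

    hom-sym : ∀ {x y} → IsHom x y → IsHom y x
    hom-sym {x} {y} hxy = [ proj₂ , (λ (axy , ayx) → trans ayx (trans (sym hxy) axy)) ]′ (hom⊎anti-pair x y)

    anti-row : ∀ {u v} → IsAnti u v → ¬ Commute (F u) (F v) → ∀ x → IsAnti u x
    anti-row {u} auv ¬uv x with hom-or-anti u x
    ... | inj₂ aux = aux
    ... | inj₁ hux = [ trans hux , (λ uv → ⊥-elim (¬uv uv)) ]′ (hom-anti-commute hux auv)

    hom-row : ∀ {u v} → IsHom u v → ¬ Commute (F u) (F v) → ∀ x → IsHom u x
    hom-row {u} huv ¬uv x with hom-or-anti u x
    ... | inj₁ hux = hux
    ... | inj₂ aux = [ (λ uv → ⊥-elim (¬uv uv)) , (λ ux → trans aux (sym ux)) ]′ (hom-anti-commute huv aux)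

    rows-clash : ∀ {a b c d} → (∀ x → IsAnti a x) → ¬ Commute (F a) (F b) →
                 (∀ x → IsHom c x) → ¬ Commute (F c) (F d) → ⊥
    rows-clash {a} {b} {c} {d} a-anti ¬ab c-hom ¬cd = clash (hom-or-anti (a ∙ c) b) (hom-or-anti (a ∙ c) d)
      where
        F-ac : F (a ∙ c) ≡ F a ∙ F c
        F-ac = hom-sym (c-hom a)
        ac≡ca : F a ∙ F c ≡ F c ∙ F a
        ac≡ca = trans (sym F-ac) (a-anti c)
        ca≡ac : c ∙ a ≡ a ∙ c
        ca≡ac = F-injective (trans (c-hom a) (trans (sym ac≡ca) (sym F-ac)))
        ¬hom-ac-b : ¬ IsHom (a ∙ c) b
        ¬hom-ac-b h = ¬ab (∙-cancelˡ (F c) _ _ (begin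
          F c ∙ (F a ∙ F b)   ≡⟨ assoc (F c) (F a) (F b) ⟨
          (F c ∙ F a) ∙ F b   ≡⟨ cong (_∙ F b) (trans (sym ac≡ca) (sym F-ac)) ⟩
          F (a ∙ c) ∙ F b     ≡⟨ h ⟨
          F ((a ∙ c) ∙ b)     ≡⟨ cong (λ w → F (w ∙ b)) (sym ca≡ac) ⟩
          F ((c ∙ a) ∙ b)     ≡⟨ cong F (assoc c a b) ⟩
          F (c ∙ (a ∙ b))     ≡⟨ c-hom (a ∙ b) ⟩
          F c ∙ F (a ∙ b)     ≡⟨ cong (F c ∙_) (a-anti b) ⟩
          F c ∙ (F b ∙ F a)   ∎))
        ¬anti-ac-d : ¬ IsAnti (a ∙ c) d
        ¬anti-ac-d k = ¬cd (sym (∙-cancelʳ (F a) _ _ (begin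
          (F d ∙ F c) ∙ F a   ≡⟨ assoc (F d) (F c) (F a) ⟩
          F d ∙ (F c ∙ F a)   ≡⟨ cong (F d ∙_) (trans (sym ac≡ca) (sym F-ac)) ⟩
          F d ∙ F (a ∙ c)     ≡⟨ k ⟨
          F ((a ∙ c) ∙ d)     ≡⟨ cong F (assoc a c d) ⟩
          F (a ∙ (c ∙ d))     ≡⟨ a-anti (c ∙ d) ⟩
          F (c ∙ d) ∙ F a     ≡⟨ cong (_∙ F a) (c-hom d) ⟩
          (F c ∙ F d) ∙ F a   ∎)))
        clash : IsHom (a ∙ c) b ⊎ IsAnti (a ∙ c) b → IsHom (a ∙ c) d ⊎ IsAnti (a ∙ c) d → ⊥
        clash (inj₁ h) _        = ¬hom-ac-b h
        clash (inj₂ _) (inj₂ k) = ¬anti-ac-d k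
        clash (inj₂ h) (inj₁ k) =
          [ (λ ac-d → ¬anti-ac-d (trans k ac-d)) , (λ ac-b → ¬hom-ac-b (trans h (sym ac-b))) ]′ (hom-anti-commute k h)

    anti-everywhere : ∀ {a b} → ¬ IsHom a b → ∀ c d → IsAnti c d
    anti-everywhere {a} {b} ¬hab c d with F (c ∙ d) ≟ F d ∙ F c
    ... | yes acd = acd
    ... | no ¬acd = ⊥-elim (rows-clash (anti-row aab ¬ab) ¬ab (hom-row hcd ¬cd) ¬cd)
      where
        aab : IsAnti a b
        aab = [ (λ hab → ⊥-elim (¬hab hab)) , id ]′ (hom-or-anti a b)
        ¬ab : ¬ Commute (F a) (F b)
        ¬ab ab = ¬hab (trans aab (sym ab))
        hcd : IsHom c d
        hcd = [ id , (λ acd → ⊥-elim (¬acd acd)) ]′ (hom-or-anti c d)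
        ¬cd : ¬ Commute (F c) (F d)
        ¬cd cd = ¬acd (trans hcd cd)

    hom⊎anti : (∀ x y → IsHom x y) ⊎ (∀ x y → IsAnti x y)
    hom⊎anti with all? (λ x → all? (λ y → F (x ∙ y) ≟ F x ∙ F y))
    ... | yes all-hom = inj₁ all-hom
    ... | no ¬all-hom with ¬∀⟶∃¬ m _ (λ x → all? (λ y → F (x ∙ y) ≟ F x ∙ F y)) ¬all-hom
    ...   | a , ¬row with ¬∀⟶∃¬ m _ (λ y → F (a ∙ y) ≟ F a ∙ F y) ¬row
    ...     | b , ¬hab = inj₂ (anti-everywhere ¬hab)

-- Jordan maps of finite connected groupoids

-- Arrows are the elements of Fin m, objects are represented by their identity arrows, and
-- Comp a b c says that c is the composite of a followed by b.
record Groupoid (m : ℕ) : Set₁ where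
  field
    Comp            : Fin m → Fin m → Fin m → Set
    comp?           : ∀ a b c → Dec (Comp a b c)
    src tgt inv     : Fin m → Fin m
    comp-exists     : ∀ a b → tgt a ≡ src b → ∃ (Comp a b)
    comp-composable : ∀ {a b c} → Comp a b c → tgt a ≡ src b
    comp-functional : ∀ {a b c c′} → Comp a b c → Comp a b c′ → c ≡ c′
    comp-cancelˡ    : ∀ {a b b′ c} → Comp a b c → Comp a b′ c → b ≡ b′
    comp-cancelʳ    : ∀ {a a′ b c} → Comp a b c → Comp a′ b c → a ≡ a′
    src-comp        : ∀ {a b c} → Comp a b c → src c ≡ src a
    tgt-comp        : ∀ {a b c} → Comp a b c → tgt c ≡ tgt b
    comp-assoc      : ∀ {a b c d e} → Comp a b d → Comp d c e → ∃ λ f → Comp b c f × Comp a f e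
    identityˡ       : ∀ a → Comp (src a) a a
    identityʳ       : ∀ a → Comp a (tgt a) a
    src-src         : ∀ a → src (src a) ≡ src a
    tgt-src         : ∀ a → tgt (src a) ≡ src a
    src-tgt         : ∀ a → src (tgt a) ≡ tgt a
    inv-comp        : ∀ a → Comp (inv a) a (tgt a)
    comp-inv        : ∀ a → Comp a (inv a) (src a)
    connected       : ∀ a b → ∃ λ c → src c ≡ tgt a × tgt c ≡ src b

module GroupoidProperties {m : ℕ} (G : Groupoid m) where
  open Groupoid G

  IsIdentity IsLoop : Fin m → Set
  IsIdentity e = src e ≡ e
  IsLoop a = src a ≡ tgt a

  Hom Anti JordanMap : (Fin m → Fin m) → Set
  Hom f = ∀ a b c → Comp a b c ⇔ Comp (f a) (f b) (f c)
  Anti f = ∀ a b c → Comp a b c ⇔ Comp (f b) (f a) (f c)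
  JordanMap f = ∀ a b c →
    χ (comp? a b c) + χ (comp? b a c) ≡ χ (comp? (f a) (f b) (f c)) + χ (comp? (f b) (f a) (f c))

  comp-assoc′ : ∀ {a b c d e f} → Comp a b d → Comp b c f → Comp d c e → Comp a f e
  comp-assoc′ {a} {e = e} abd bcf dce =
    let (f′ , bcf′ , af′e) = comp-assoc abd dce in subst (λ u → Comp a u e) (comp-functional bcf′ bcf) af′e

  identity-tgt : ∀ {e} → IsIdentity e → tgt e ≡ e
  identity-tgt {e} id-e = trans (cong tgt (sym id-e)) (trans (tgt-src e) id-e)

  identity-idempotent : ∀ {e} → IsIdentity e → Comp e e e
  identity-idempotent {e} id-e = subst (λ u → Comp u e e) id-e (identityˡ e)

  idempotent-identity : ∀ {e} → Comp e e e → IsIdentity e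
  idempotent-identity {e} eee = trans (sym (comp-composable eee)) (sym (comp-cancelˡ eee (identityʳ e)))

  unitˡ-src : ∀ {u a} → IsIdentity u → Comp u a a → u ≡ src a
  unitˡ-src id-u uaa = trans (sym id-u) (sym (src-comp uaa))

  unitʳ-tgt : ∀ {u a} → IsIdentity u → Comp a u a → u ≡ tgt a
  unitʳ-tgt id-u auu = trans (sym (identity-tgt id-u)) (sym (tgt-comp auu))

  src-inv : ∀ a → src (inv a) ≡ tgt a
  src-inv a = trans (sym (src-comp (inv-comp a))) (src-tgt a)

  tgt-inv : ∀ a → tgt (inv a) ≡ src a
  tgt-inv a = trans (sym (tgt-comp (comp-inv a))) (tgt-src a)

  inverse-unique : ∀ {a b} → Comp a b (src a) → b ≡ inv a
  inverse-unique {a} ab = comp-cancelˡ ab (comp-inv a)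

  inv-involutive : ∀ a → inv (inv a) ≡ a
  inv-involutive a =
    sym (comp-cancelʳ (comp-inv a) (subst (Comp (inv (inv a)) (inv a)) (tgt-inv a) (inv-comp (inv a))))

  inv-identity : ∀ {e} → IsIdentity e → inv e ≡ e
  inv-identity {e} id-e = sym (inverse-unique (subst (Comp e e) (sym id-e) (identity-idempotent id-e)))

  inv-anti : ∀ {a b c} → Comp a b c → Comp (inv b) (inv a) (inv c)
  inv-anti {a} {b} {c} abc =
    let (d , b⁻a⁻d) = comp-exists (inv b) (inv a)
                        (trans (tgt-inv b) (trans (sym (comp-composable abc)) (sym (src-inv a))))
        (e , cb⁻e)  = comp-exists c (inv b) (trans (tgt-comp abc) (sym (src-inv b)))
        e≡a         = comp-functional (comp-assoc′ abc (comp-inv b) cb⁻e)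
                        (subst (λ u → Comp a u a) (comp-composable abc) (identityʳ a))
        c-d         = comp-assoc′ (subst (Comp c (inv b)) e≡a cb⁻e) b⁻a⁻d (comp-inv a)
    in subst (Comp (inv b) (inv a)) (inverse-unique (subst (Comp c d) (sym (src-comp abc)) c-d)) b⁻a⁻d

  inv-anti⁻ : ∀ {a b c} → Comp (inv b) (inv a) (inv c) → Comp a b c
  inv-anti⁻ {a} {b} {c} p =
    subst₂ (λ u v → Comp u v c) (inv-involutive a) (inv-involutive b)
      (subst (Comp (inv (inv a)) (inv (inv b))) (inv-involutive c) (inv-anti p))

module JordanOrientation {m : ℕ} (G : Groupoid m) (f : Fin m → Fin m)
    (f-injective : ∀ {a b} → f a ≡ f b → a ≡ b) (jordan : GroupoidProperties.JordanMap G f) where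
  open Groupoid G
  open GroupoidProperties G

  comp-image : ∀ {a b c} → Comp a b c → Comp (f a) (f b) (f c) ⊎ Comp (f b) (f a) (f c)
  comp-image {a} {b} {c} =
    χ+χ-any (comp? a b c) (comp? b a c) (comp? (f a) (f b) (f c)) (comp? (f b) (f a) (f c)) (jordan a b c)

  comp-image₂ : ∀ {a b c} → Comp a b c → Comp b a c → Comp (f a) (f b) (f c) × Comp (f b) (f a) (f c)
  comp-image₂ {a} {b} {c} =
    χ+χ-both (comp? a b c) (comp? b a c) (comp? (f a) (f b) (f c)) (comp? (f b) (f a) (f c)) (jordan a b c)

  identity-image : ∀ {e} → IsIdentity e → IsIdentity (f e)
  identity-image id-e =
    idempotent-identity (proj₁ (comp-image₂ (identity-idempotent id-e) (identity-idempotent id-e)))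

  Preserves Reverses : Fin m → Set
  Preserves a = f (src a) ≡ src (f a) × f (tgt a) ≡ tgt (f a)
  Reverses a = f (src a) ≡ tgt (f a) × f (tgt a) ≡ src (f a)

  src-image : ∀ a → f (src a) ≡ src (f a) ⊎ f (src a) ≡ tgt (f a)
  src-image a = [ inj₁ ∘ unitˡ-src id-fsrc , inj₂ ∘ unitʳ-tgt id-fsrc ]′ (comp-image (identityˡ a))
    where id-fsrc = identity-image (src-src a)

  tgt-image : ∀ a → f (tgt a) ≡ tgt (f a) ⊎ f (tgt a) ≡ src (f a)
  tgt-image a = [ inj₁ ∘ unitʳ-tgt id-ftgt , inj₂ ∘ unitˡ-src id-ftgt ]′ (comp-image (identityʳ a))
    where id-ftgt = identity-image (src-tgt a)

  loop-image : ∀ {a} → IsLoop a → f (src a) ≡ src (f a) × f (src a) ≡ tgt (f a)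
  loop-image {a} loop =
    Product.map (unitˡ-src id-fsrc) (unitʳ-tgt id-fsrc)
      (comp-image₂ (identityˡ a) (subst (λ u → Comp a u a) (sym loop) (identityʳ a)))
    where id-fsrc = identity-image (src-src a)

  loop-preserves : ∀ {a} → IsLoop a → Preserves a
  loop-preserves loop = let (s , t) = loop-image loop in s , trans (cong f (sym loop)) t

  loop-reverses : ∀ {a} → IsLoop a → Reverses a
  loop-reverses loop = let (s , t) = loop-image loop in t , trans (cong f (sym loop)) s

  orientation : ∀ a → Preserves a ⊎ Reverses a
  orientation a with src a ≟ tgt a | src-image a | tgt-image a
  ... | yes loop  | _      | _      = inj₁ (loop-preserves loop)
  ... | no _      | inj₁ s | inj₁ t = inj₁ (s , t)
  ... | no _      | inj₂ s | inj₂ t = inj₂ (s , t)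
  ... | no ¬loop  | inj₁ s | inj₂ t = ⊥-elim (¬loop (f-injective (trans s (sym t))))
  ... | no ¬loop  | inj₂ s | inj₁ t = ⊥-elim (¬loop (f-injective (trans s (sym t))))

  preserves∧reverses⇒loop : ∀ {a} → Preserves a → Reverses a → IsLoop a
  preserves∧reverses⇒loop (ps , _) (_ , rt) = f-injective (trans ps (sym rt))

  mixed-comp-loop : ∀ {a b c} → Comp a b c → Preserves a → Reverses b → IsLoop a ⊎ IsLoop b
  mixed-comp-loop abc (ps-a , pt-a) (rs-b , rt-b) with comp-image abc
  ... | inj₁ q = inj₂ (trans (sym (comp-composable abc))
                         (f-injective (trans pt-a (trans (comp-composable q) (sym rt-b)))))
  ... | inj₂ q = inj₁ (trans (f-injective (trans ps-a (trans (sym (comp-composable q)) (sym rs-b))))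
                         (sym (comp-composable abc)))

  preserves-forward : ∀ {a b c} → Comp a b c → ¬ IsLoop a → ¬ IsLoop b → Preserves a → Preserves b
  preserves-forward {b = b} abc ¬La ¬Lb pa =
    [ id , (λ rb → ⊥-elim ([ ¬La , ¬Lb ]′ (mixed-comp-loop abc pa rb))) ]′ (orientation b)

  preserves-uniform : ∀ {a b} → ¬ IsLoop a → ¬ IsLoop b → Preserves a → Preserves b
  preserves-uniform {a} {b} ¬La ¬Lb pa with connected a b
  ... | c , sc , tc with src c ≟ tgt c
  ...   | yes Lc = preserves-forward (proj₂ (comp-exists a b (trans (sym sc) (trans Lc tc)))) ¬La ¬Lb pa
  ...   | no ¬Lc = preserves-forward (proj₂ (comp-exists c b tc)) ¬Lc ¬Lb
                     (preserves-forward (proj₂ (comp-exists a c (sym sc))) ¬La ¬Lc pa)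

  reverses-uniform : ∀ {a b} → ¬ IsLoop a → ¬ IsLoop b → Reverses a → Reverses b
  reverses-uniform {a} {b} ¬La ¬Lb ra =
    [ (λ pb → ⊥-elim (¬La (preserves∧reverses⇒loop (preserves-uniform ¬Lb ¬La pb) ra))) , id ]′ (orientation b)

  all-preserve : ∀ {a₀} → ¬ IsLoop a₀ → Preserves a₀ → ∀ a → Preserves a
  all-preserve ¬L₀ p₀ a with src a ≟ tgt a
  ... | yes loop = loop-preserves loop
  ... | no ¬loop = preserves-uniform ¬L₀ ¬loop p₀

  all-reverse : ∀ {a₀} → ¬ IsLoop a₀ → Reverses a₀ → ∀ a → Reverses a
  all-reverse ¬L₀ r₀ a with src a ≟ tgt a
  ... | yes loop = loop-reverses loop
  ... | no ¬loop = reverses-uniform ¬L₀ ¬loop r₀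

  module Preserving (all-pres : ∀ a → Preserves a) {a₀ : Fin m} (¬L₀ : ¬ IsLoop a₀) where

    composable-image : ∀ {a b c} → Comp a b c → tgt (f a) ≡ src (f b)
    composable-image {a} {b} abc =
      trans (sym (proj₂ (all-pres a))) (trans (cong f (comp-composable abc)) (proj₁ (all-pres b)))

    reversed-image-loop : ∀ {a b c} → Comp a b c → Comp (f b) (f a) (f c) → IsLoop b
    reversed-image-loop {a} {b} {c} abc q = trans (sym (comp-composable abc)) (sym tgt-b≡tgt-a)
      where
        tgt-b≡tgt-a : tgt b ≡ tgt a
        tgt-b≡tgt-a = f-injective (trans (cong f (sym (tgt-comp abc)))
                        (trans (proj₂ (all-pres c)) (trans (tgt-comp q) (sym (proj₂ (all-pres a))))))

    comp-image-nonloop : ∀ {a b c} → Comp a b c → ¬ IsLoop b → Comp (f a) (f b) (f c)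
    comp-image-nonloop abc ¬Lb = [ id , (λ q → ⊥-elim (¬Lb (reversed-image-loop abc q))) ]′ (comp-image abc)

    exit : ∀ u → ∃ λ x → src x ≡ tgt u × ¬ IsLoop x
    exit u with tgt u ≟ src a₀
    ... | yes e = a₀ , sym e , ¬L₀
    ... | no ¬e = let (x , sx , tx) = connected u a₀ in x , sx , λ Lx → ¬e (trans (sym sx) (trans Lx tx))

    -- Factor through a non-loop x leaving the vertex of the loop b: with q = b x and r = a q = c x, the
    -- images of these non-loop composites force f a · f b = f c by cancelling f x.
    comp-image-loop : ∀ {a b c} → Comp a b c → IsLoop b → Comp (f a) (f b) (f c)
    comp-image-loop {a} {b} {c} abc Lb =
      let (x , sx , ¬Lx) = exit b
          (q , bxq)      = comp-exists b x (sym sx)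
          (r , aqr)      = comp-exists a q (trans (comp-composable abc) (sym (src-comp bxq)))
          (r′ , cxr′)    = comp-exists c x (trans (tgt-comp abc) (sym sx))
          cxr            = subst (Comp c x) (comp-functional (comp-assoc′ abc bxq cxr′) aqr) cxr′
          ¬Lq            = λ Lq → ¬Lx (trans sx (trans (sym Lb)
                             (trans (sym (src-comp bxq)) (trans Lq (tgt-comp bxq)))))
          fb-fx          = comp-image-nonloop bxq ¬Lx
          (w , fa-fb)    = comp-exists (f a) (f b) (composable-image abc)
          (v , w-fx)     = comp-exists w (f x) (trans (tgt-comp fa-fb) (comp-composable fb-fx))
          v≡fr           = comp-functional (comp-assoc′ fa-fb fb-fx w-fx) (comp-image-nonloop aqr ¬Lq)
          w≡fc           = comp-cancelʳ (subst (Comp w (f x)) v≡fr w-fx) (comp-image-nonloop cxr ¬Lx)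
      in subst (Comp (f a) (f b)) w≡fc fa-fb

    comp-image-forward : ∀ {a b c} → Comp a b c → Comp (f a) (f b) (f c)
    comp-image-forward {b = b} abc with src b ≟ tgt b
    ... | yes Lb = comp-image-loop abc Lb
    ... | no ¬Lb = comp-image-nonloop abc ¬Lb

    comp-image-backward : ∀ {a b c} → Comp (f a) (f b) (f c) → Comp a b c
    comp-image-backward {a} {b} q =
      let (c′ , abc′) = comp-exists a b (f-injective
                          (trans (proj₂ (all-pres a)) (trans (comp-composable q) (sym (proj₁ (all-pres b))))))
      in subst (Comp a b) (f-injective (comp-functional (comp-image-forward abc′) q)) abc′

    hom : Hom f
    hom a b c = mk⇔ comp-image-forward comp-image-backward

module _ {m : ℕ} (G : Groupoid m) where
  open Groupoid G
  open GroupoidProperties G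

  jordan-nonloop⇒hom⊎anti : (f : Fin m → Fin m) → (∀ {a b} → f a ≡ f b → a ≡ b) → JordanMap f →
                            ∀ {a₀} → ¬ IsLoop a₀ → Hom f ⊎ Anti f
  jordan-nonloop⇒hom⊎anti f f-injective jordan {a₀} ¬L₀ = by-orientation (F.orientation a₀)
    where
      module F = JordanOrientation G f f-injective jordan

      -- If f reverses the ends of non-loops, inv ∘ f preserves them.
      ψ : Fin m → Fin m
      ψ a = inv (f a)

      ψ-injective : ∀ {a b} → ψ a ≡ ψ b → a ≡ b
      ψ-injective {a} {b} e =
        f-injective (trans (sym (inv-involutive (f a))) (trans (cong inv e) (inv-involutive (f b))))

      χ-inv : ∀ a b c → χ (comp? (f b) (f a) (f c)) ≡ χ (comp? (ψ a) (ψ b) (ψ c))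
      χ-inv a b c = χ-cong inv-anti inv-anti⁻ (comp? (f b) (f a) (f c)) (comp? (ψ a) (ψ b) (ψ c))

      ψ-jordan : JordanMap ψ
      ψ-jordan a b c = trans (jordan a b c)
        (trans (+-comm (χ (comp? (f a) (f b) (f c))) _) (cong₂ _+_ (χ-inv a b c) (χ-inv b a c)))

      module Ψ = JordanOrientation G ψ ψ-injective ψ-jordan

      ψ-preserves : F.Reverses a₀ → ∀ a → Ψ.Preserves a
      ψ-preserves r₀ a = let (rs , rt) = F.all-reverse ¬L₀ r₀ a in
        trans (inv-identity (F.identity-image (src-src a))) (trans rs (sym (src-inv (f a)))) ,
        trans (inv-identity (F.identity-image (src-tgt a))) (trans rt (sym (tgt-inv (f a))))

      by-orientation : F.Preserves a₀ ⊎ F.Reverses a₀ → Hom f ⊎ Anti f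
      by-orientation (inj₁ p₀) = inj₁ (F.Preserving.hom (F.all-preserve ¬L₀ p₀) ¬L₀)
      by-orientation (inj₂ r₀) = inj₂ λ a b c →
        mk⇔ (inv-anti⁻ ∘ Equivalence.to (ψ-hom a b c)) (Equivalence.from (ψ-hom a b c) ∘ inv-anti)
        where
          ψ-hom : Hom ψ
          ψ-hom = Ψ.Preserving.hom (ψ-preserves r₀) ¬L₀

module SingleObject {m : ℕ} (G : Groupoid m) (all-loops : ∀ a → GroupoidProperties.IsLoop G a) (a₀ : Fin m)
    where
  open Groupoid G
  open GroupoidProperties G

  composable : ∀ a b → tgt a ≡ src b
  composable a b = let (c , sc , tc) = connected a b in trans (sym sc) (trans (all-loops c) tc)

  _∙_ : Fin m → Fin m → Fin m
  a ∙ b = proj₁ (comp-exists a b (composable a b))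

  comp-∙ : ∀ a b → Comp a b (a ∙ b)
  comp-∙ a b = proj₂ (comp-exists a b (composable a b))

  comp⇔∙ : ∀ {a b c} → Comp a b c ⇔ a ∙ b ≡ c
  comp⇔∙ {a} {b} = mk⇔ (comp-functional (comp-∙ a b)) (λ e → subst (Comp a b) e (comp-∙ a b))

  ε : Fin m
  ε = src a₀

  src≡ε : ∀ a → src a ≡ ε
  src≡ε a = trans (all-loops a) (composable a a₀)

  isGroup : IsGroup _≡_ _∙_ ε inv
  isGroup = record
    { isMonoid = record
      { isSemigroup = record
        { isMagma = record { isEquivalence = isEquivalence ; ∙-cong = cong₂ _∙_ }
        ; assoc = λ a b c → sym (Equivalence.to comp⇔∙
                    (comp-assoc′ (comp-∙ a b) (comp-∙ b c) (comp-∙ (a ∙ b) c)))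
        }
      ; identity = (λ a → Equivalence.to comp⇔∙ (subst (λ u → Comp u a a) (src≡ε a) (identityˡ a)))
                 , (λ a → Equivalence.to comp⇔∙
                            (subst (λ u → Comp a u a) (trans (sym (all-loops a)) (src≡ε a)) (identityʳ a)))
      }
    ; inverse = (λ a → trans (Equivalence.to comp⇔∙ (inv-comp a)) (trans (sym (all-loops a)) (src≡ε a)))
              , (λ a → trans (Equivalence.to comp⇔∙ (comp-inv a)) (src≡ε a))
    ; ⁻¹-cong = cong inv
    }

  δ-∙ : ∀ a b c → δ c (a ∙ b) ≡ χ (comp? a b c)
  δ-∙ a b c = χ-cong (Equivalence.from comp⇔∙ ∘ sym) (sym ∘ Equivalence.to comp⇔∙) (c ≟ a ∙ b) (comp? a b c)

  jordan-loops⇒hom⊎anti : (φ : Permutation′ m) → JordanMap (φ ⟨$⟩ʳ_) → Hom (φ ⟨$⟩ʳ_) ⊎ Anti (φ ⟨$⟩ʳ_)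
  jordan-loops⇒hom⊎anti φ jordan =
    Sum.map (λ h a b → comp-image⇔ (h a b)) (λ h a b → comp-image⇔ (h a b)) J.hom⊎anti
    where
      f : Fin m → Fin m
      f = φ ⟨$⟩ʳ_
      f-injective : ∀ {a b} → f a ≡ f b → a ≡ b
      f-injective = Injection.injective (↔⇒↣ φ)
      pair : ∀ a b d → ⟅ f (a ∙ b) , f (b ∙ a) ⟆ d ≡ ⟅ f a ∙ f b , f b ∙ f a ⟆ d
      pair a b d = begin
        δ d (f (a ∙ b)) + δ d (f (b ∙ a))
          ≡⟨ cong₂ _+_ (trans (δ-permute φ d (a ∙ b)) (δ-∙ a b d′))
                       (trans (δ-permute φ d (b ∙ a)) (δ-∙ b a d′)) ⟩
        χ (comp? a b d′) + χ (comp? b a d′)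
          ≡⟨ jordan a b d′ ⟩
        χ (comp? (f a) (f b) (f d′)) + χ (comp? (f b) (f a) (f d′))
          ≡⟨ cong₂ _+_ (sym (δ-∙ (f a) (f b) (f d′))) (sym (δ-∙ (f b) (f a) (f d′))) ⟩
        δ (f d′) (f a ∙ f b) + δ (f d′) (f b ∙ f a)
          ≡⟨ cong (λ u → ⟅ f a ∙ f b , f b ∙ f a ⟆ u) (inverseʳ φ) ⟩
        δ d (f a ∙ f b) + δ d (f b ∙ f a) ∎
        where
          open ≡-Reasoning
          d′ : Fin m
          d′ = φ ⟨$⟩ˡ d
      module J = JordanGroupMap.Map isGroup f f-injective pair
      comp-image⇔ : ∀ {a b a′ b′} → f (a ∙ b) ≡ a′ ∙ b′ → ∀ c → Comp a b c ⇔ Comp a′ b′ (f c)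
      comp-image⇔ fab c = mk⇔
        (λ abc → Equivalence.from comp⇔∙ (trans (sym fab) (cong f (Equivalence.to comp⇔∙ abc))))
        (λ q → Equivalence.from comp⇔∙ (f-injective (trans fab (Equivalence.to comp⇔∙ q))))

jordan⇒hom⊎anti : ∀ {m} (G : Groupoid m) (φ : Permutation′ m) → GroupoidProperties.JordanMap G (φ ⟨$⟩ʳ_) →
                  GroupoidProperties.Hom G (φ ⟨$⟩ʳ_) ⊎ GroupoidProperties.Anti G (φ ⟨$⟩ʳ_)
jordan⇒hom⊎anti {zero} G φ jordan = inj₁ (λ ())
jordan⇒hom⊎anti {suc m} G φ jordan with any? (λ a → ¬? (Groupoid.src G a ≟ Groupoid.tgt G a))
... | yes (a₀ , ¬L₀) = jordan-nonloop⇒hom⊎anti G (φ ⟨$⟩ʳ_) (Injection.injective (↔⇒↣ φ)) jordan ¬L₀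
... | no ¬∃ = SingleObject.jordan-loops⇒hom⊎anti G all-loops zero φ jordan
  where
    all-loops : ∀ a → Groupoid.src G a ≡ Groupoid.tgt G a
    all-loops a = decidable-stable (Groupoid.src G a ≟ Groupoid.tgt G a) (λ ¬L → ¬∃ (a , ¬L))

-- Semiregular permutation groups

module SemiregularAction {n : ℕ} {H : Permutation′ n → Set} (sg : IsSubgroup H) (sr : Semiregular H) where
  open IsSubgroup sg

  SameOrbit₂ : Fin n → Fin n → Fin n → Fin n → Set
  SameOrbit₂ x y x′ y′ = Σ (Permutation′ n) λ h → H h × h ⟨$⟩ʳ x ≡ x′ × h ⟨$⟩ʳ y ≡ y′

  semiregular-agree : ∀ {h h′} → H h → H h′ → ∀ {p} → h ⟨$⟩ʳ p ≡ h′ ⟨$⟩ʳ p → ∀ q → h ⟨$⟩ʳ q ≡ h′ ⟨$⟩ʳ q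
  semiregular-agree {h} {h′} Hh Hh′ {p} agree q =
    trans (sym (inverseʳ h′)) (cong (h′ ⟨$⟩ʳ_) (sr (h ∘ₚ flip h′) (closed∘ Hh (closed⁻ Hh′)) p fixes-p q))
    where
      fixes-p : h′ ⟨$⟩ˡ (h ⟨$⟩ʳ p) ≡ p
      fixes-p = trans (cong (h′ ⟨$⟩ˡ_) agree) (inverseˡ h′)

module OrbitCoordinates {n : ℕ} {H : Permutation′ n → Set} (sg : IsSubgroup H) (sr : Semiregular H)
    {n₁ : ℕ} {ι : Fin n₁ → Fin n} (ιH : IsOrbitEmbedding H ι)
    {k : ℕ} {orb : Fin n → Fin k} (orbH : IsOrbitCount H orb) where

  open IsSubgroup sg
  open SemiregularAction sg sr

  x₀ : Fin n
  x₀ = proj₁ (proj₂ ιH)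

  representative : Fin k → Fin n
  representative i = proj₁ (proj₁ orbH i)

  orb-representative : ∀ i → orb (representative i) ≡ i
  orb-representative i = proj₂ (proj₁ orbH i)

  orb-invariant : ∀ {h} → H h → ∀ x → orb (h ⟨$⟩ʳ x) ≡ orb x
  orb-invariant {h} Hh x = sym (proj₂ (proj₂ orbH x (h ⟨$⟩ʳ x)) (h , Hh , refl))

  -- By semiregularity g x is the only element of H carrying the representative of the orbit of x to x.
  g-exists : ∀ x → Σ (Permutation′ n) λ h → H h × h ⟨$⟩ʳ representative (orb x) ≡ x
  g-exists x = proj₁ (proj₂ orbH (representative (orb x)) x) (orb-representative (orb x))

  g : Fin n → Permutation′ n
  g x = proj₁ (g-exists x)

  g∈H : ∀ x → H (g x)
  g∈H x = proj₁ (proj₂ (g-exists x))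

  g-representative : ∀ x → g x ⟨$⟩ʳ representative (orb x) ≡ x
  g-representative x = proj₂ (proj₂ (g-exists x))

  offset-exists : ∀ x → Σ (Fin n₁) λ a → ι a ≡ g x ⟨$⟩ʳ x₀
  offset-exists x = proj₂ (proj₂ (proj₂ ιH) (g x ⟨$⟩ʳ x₀)) (g x , g∈H x , refl)

  offset : Fin n → Fin n₁
  offset x = proj₁ (offset-exists x)

  ι-offset : ∀ x → ι (offset x) ≡ g x ⟨$⟩ʳ x₀
  ι-offset x = proj₂ (offset-exists x)

  lift-exists : ∀ a → Σ (Permutation′ n) λ h → H h × h ⟨$⟩ʳ x₀ ≡ ι a
  lift-exists a = proj₁ (proj₂ (proj₂ ιH) (ι a)) (a , refl)

  lift : Fin n₁ → Permutation′ n
  lift a = proj₁ (lift-exists a)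

  lift∈H : ∀ a → H (lift a)
  lift∈H a = proj₁ (proj₂ (lift-exists a))

  lift-x₀ : ∀ a → lift a ⟨$⟩ʳ x₀ ≡ ι a
  lift-x₀ a = proj₂ (proj₂ (lift-exists a))

  maps-representative : ∀ {h x} → H h → h ⟨$⟩ʳ x₀ ≡ ι (offset x) → h ⟨$⟩ʳ representative (orb x) ≡ x
  maps-representative {h} {x} Hh e =
    trans (semiregular-agree Hh (g∈H x) (trans e (ι-offset x)) (representative (orb x))) (g-representative x)

  offset-equivariant : ∀ {h} → H h → ∀ x → ι (offset (h ⟨$⟩ʳ x)) ≡ h ⟨$⟩ʳ ι (offset x)
  offset-equivariant {h} Hh x =
    trans (ι-offset hx)
      (trans (semiregular-agree (g∈H hx) (closed∘ (g∈H x) Hh) agree x₀) (cong (h ⟨$⟩ʳ_) (sym (ι-offset x))))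
    where
      hx : Fin n
      hx = h ⟨$⟩ʳ x
      agree : g hx ⟨$⟩ʳ representative (orb x) ≡ h ⟨$⟩ʳ (g x ⟨$⟩ʳ representative (orb x))
      agree = trans (cong (λ i → g hx ⟨$⟩ʳ representative i) (sym (orb-invariant Hh x)))
                    (trans (g-representative hx) (cong (h ⟨$⟩ʳ_) (sym (g-representative x))))

  transport-by-offset : ∀ {h x x′} → H h → h ⟨$⟩ʳ ι (offset x) ≡ ι (offset x′) → orb x ≡ orb x′ → h ⟨$⟩ʳ x ≡ x′
  transport-by-offset {h} {x} {x′} Hh e o =
    trans (cong (h ⟨$⟩ʳ_) (sym (g-representative x)))
      (trans (cong (λ i → h ⟨$⟩ʳ (g x ⟨$⟩ʳ representative i)) o)
        (maps-representative (closed∘ (g∈H x) Hh) (trans (cong (h ⟨$⟩ʳ_) (sym (ι-offset x))) e)))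

  coordinates : Fin n ↔ (Fin n₁ × Fin k)
  coordinates = mk↔ₛ′ (λ x → offset x , orb x) point coordinates-point point-coordinates
    where
      point : Fin n₁ × Fin k → Fin n
      point (a , i) = lift a ⟨$⟩ʳ representative i
      orb-point : ∀ a i → orb (point (a , i)) ≡ i
      orb-point a i = trans (orb-invariant (lift∈H a) (representative i)) (orb-representative i)
      coordinates-point : ∀ p → (offset (point p) , orb (point p)) ≡ p
      coordinates-point (a , i) = cong₂ _,_ (proj₁ ιH _ _ ι-offset-point) (orb-point a i)
        where
          X : Fin n
          X = point (a , i)
          agree : g X ⟨$⟩ʳ representative (orb X) ≡ lift a ⟨$⟩ʳ representative (orb X)
          agree = trans (g-representative X) (cong (λ j → lift a ⟨$⟩ʳ representative j) (sym (orb-point a i)))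
          ι-offset-point : ι (offset X) ≡ ι a
          ι-offset-point = trans (ι-offset X) (trans (semiregular-agree (g∈H X) (lift∈H a) agree x₀) (lift-x₀ a))
      point-coordinates : ∀ x → point (offset x , orb x) ≡ x
      point-coordinates x = maps-representative (lift∈H (offset x)) (lift-x₀ (offset x))

  SameCoordinates₂ : Fin n → Fin n → Fin n → Fin n → Set
  SameCoordinates₂ x y x′ y′ =
    SameOrbit₂ (ι (offset x)) (ι (offset y)) (ι (offset x′)) (ι (offset y′)) × orb x ≡ orb x′ × orb y ≡ orb y′

  sameOrbit₂⇔sameCoordinates₂ : ∀ x y x′ y′ → SameOrbit₂ x y x′ y′ ⇔ SameCoordinates₂ x y x′ y′
  sameOrbit₂⇔sameCoordinates₂ x y x′ y′ = mk⇔ forth back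
    where
      moves : ∀ {h} → H h → ∀ {z z′} → h ⟨$⟩ʳ z ≡ z′ → h ⟨$⟩ʳ ι (offset z) ≡ ι (offset z′)
      moves Hh {z} refl = sym (offset-equivariant Hh z)
      stays : ∀ {h} → H h → ∀ {z z′} → h ⟨$⟩ʳ z ≡ z′ → orb z ≡ orb z′
      stays Hh {z} refl = sym (orb-invariant Hh z)
      forth : SameOrbit₂ x y x′ y′ → SameCoordinates₂ x y x′ y′
      forth (h , Hh , hx , hy) = (h , Hh , moves Hh hx , moves Hh hy) , stays Hh hx , stays Hh hy
      back : SameCoordinates₂ x y x′ y′ → SameOrbit₂ x y x′ y′
      back ((h , Hh , hx , hy) , ox , oy) = h , Hh , transport-by-offset Hh hx ox , transport-by-offset Hh hy oy

orbit-decomposition :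
  ∀ {n} {H : Permutation′ n → Set} → IsSubgroup H → Semiregular H →
  ∀ {m} {col : Fin n → Fin n → Fin m} → IsTwoOrbitColouring H col →
  ∀ {n₁} {ι : Fin n₁ → Fin n} → IsOrbitEmbedding H ι →
  ∀ {m₁} {col₁ : Fin n₁ → Fin n₁ → Fin m₁} → IsTwoOrbitColouringOn H ι col₁ →
  ∀ {k} {orb : Fin n → Fin k} → IsOrbitCount H orb →
  CombIso col (col₁ ⊗ discrete k)
orbit-decomposition {n} sg sr {col = col} (surj , col-orbit) ιH {m₁} {col₁} (surj₁ , col₁-orbit) {k} {orb} orbH =
  combIso-intro surj (⊗-surjective surj₁ (discrete-surjective k)) coordinates same-colour
  where
    open OrbitCoordinates sg sr ιH orbH
    colour : Fin n → Fin n → Fin m₁ × Fin k × Fin k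
    colour x y = col₁ (offset x) (offset y) , orb x , orb y
    same-colour : ∀ x y x′ y′ → col x y ≡ col x′ y′ ⇔ colour x y ≡ colour x′ y′
    same-colour x y x′ y′ = mk⇔ forth back
      where
        open Equivalence (sameOrbit₂⇔sameCoordinates₂ x y x′ y′)
        forth : col x y ≡ col x′ y′ → colour x y ≡ colour x′ y′
        forth e with to (proj₁ (col-orbit x y x′ y′) e)
        ... | s , ox , oy = cong₂ _,_ (proj₂ (col₁-orbit _ _ _ _) s) (cong₂ _,_ ox oy)
        back : colour x y ≡ colour x′ y′ → col x y ≡ col x′ y′
        back e with ,-injective e
        ... | e₁ , e₂ = proj₂ (col-orbit x y x′ y′) (from (proj₁ (col₁-orbit _ _ _ _) e₁ , ,-injective e₂))

module TwoOrbitColouring {n : ℕ} {H : Permutation′ n → Set} (sg : IsSubgroup H) (sr : Semiregular H)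
    {m : ℕ} {col : Fin n → Fin n → Fin m} (colH : IsTwoOrbitColouring H col) where

  open SemiregularAction sg sr
  open Coefficients col (proj₁ colH)

  col-invariant : ∀ {h} → H h → ∀ x y → col (h ⟨$⟩ʳ x) (h ⟨$⟩ʳ y) ≡ col x y
  col-invariant {h} Hh x y = sym (proj₂ (proj₂ colH x y _ _) (h , Hh , refl , refl))

  col-transport : ∀ {x y x′ y′} → col x y ≡ col x′ y′ → SameOrbit₂ x y x′ y′
  col-transport = proj₁ (proj₂ colH _ _ _ _)

  col-swap : ∀ {p q p′ q′} → col p q ≡ col p′ q′ → col q p ≡ col q′ p′
  col-swap e = let (h , Hh , hp , hq) = col-transport e in
    proj₂ (proj₂ colH _ _ _ _) (h , Hh , hq , hp)

  col-glue : ∀ {p q r p′ q′ r′} → col p q ≡ col p′ q′ → col p r ≡ col p′ r′ → col q r ≡ col q′ r′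
  col-glue {p} {q} {r} e e′ =
    let (h , Hh , hp , hq) = col-transport e ; (k , Hk , kp , kr) = col-transport e′ in
    trans (sym (col-invariant Hh q r))
          (cong₂ col hq (trans (semiregular-agree Hh Hk (trans hp (sym kp)) r) kr))

  col-injectiveʳ : ∀ {x z z′} → col x z ≡ col x z′ → z ≡ z′
  col-injectiveʳ {x} {z} e = let (h , Hh , hx , hz) = col-transport e in trans (sym (sr h Hh x hx z)) hz

  source target : Fin m → Fin n
  source c = proj₁ (proj₁ colH c)
  target c = proj₁ (proj₂ (proj₁ colH c))

  col-source-target : ∀ c → col (source c) (target c) ≡ c
  col-source-target c = proj₂ (proj₂ (proj₁ colH c))

  loop-at-source : ∀ {x y a} → col x y ≡ a → col (source a) (source a) ≡ col x x
  loop-at-source e = let (h , Hh , hs , _) = col-transport (trans (col-source-target _) (sym e)) in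
    trans (sym (col-invariant Hh _ _)) (cong₂ col hs hs)

  loop-at-target : ∀ {x y a} → col x y ≡ a → col (target a) (target a) ≡ col y y
  loop-at-target e = let (h , Hh , _ , ht) = col-transport (trans (col-source-target _) (sym e)) in
    trans (sym (col-invariant Hh _ _)) (cong₂ col ht ht)

  Triangle : Fin m → Fin m → Fin m → Set
  Triangle a b c = ∃ λ x → ∃ λ z → ∃ λ y → col x z ≡ a × col z y ≡ b × col x y ≡ c

  triangle? : ∀ a b c → Dec (Triangle a b c)
  triangle? a b c = any? λ x → any? λ z → any? λ y → (col x z ≟ a) ×-dec (col z y ≟ b) ×-dec (col x y ≟ c)

  colourGroupoid : Groupoid m
  colourGroupoid = record
    { Comp = Triangle
    ; comp? = triangle?
    ; src = λ a → col (source a) (source a)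
    ; tgt = λ a → col (target a) (target a)
    ; inv = λ a → col (target a) (source a)
    ; comp-exists = λ a b e → let (k , Hk , ks , _) = col-transport (sym e) in
        col (source a) (k ⟨$⟩ʳ target b) ,
        source a , target a , k ⟨$⟩ʳ target b , col-source-target a ,
        trans (cong (λ u → col u (k ⟨$⟩ʳ target b)) (sym ks)) (trans (col-invariant Hk _ _) (col-source-target b)) ,
        refl
    ; comp-composable = λ (_ , _ , _ , xz , zy , _) → trans (loop-at-target xz) (sym (loop-at-source zy))
    ; comp-functional = λ (_ , _ , _ , xz , zy , xy) (_ , _ , _ , xz′ , zy′ , xy′) →
        trans (sym xy) (trans (col-glue (col-swap (trans xz (sym xz′))) (trans zy (sym zy′))) xy′)
    ; comp-cancelˡ = λ (_ , _ , _ , xz , zy , xy) (_ , _ , _ , xz′ , zy′ , xy′) →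
        trans (sym zy) (trans (col-glue (trans xz (sym xz′)) (trans xy (sym xy′))) zy′)
    ; comp-cancelʳ = λ (_ , _ , _ , xz , zy , xy) (_ , _ , _ , xz′ , zy′ , xy′) →
        trans (sym xz)
          (trans (col-swap (col-glue (col-swap (trans zy (sym zy′))) (col-swap (trans xy (sym xy′))))) xz′)
    ; src-comp = λ (_ , _ , _ , xz , _ , xy) → trans (loop-at-source xy) (sym (loop-at-source xz))
    ; tgt-comp = λ (_ , _ , _ , _ , zy , xy) → trans (loop-at-target xy) (sym (loop-at-target zy))
    ; comp-assoc = λ (x , z , y , xz , zy , xy) (x′ , y′ , w , x′y′ , y′w , x′w) →
        let (h , Hh , hx′ , hy′) = col-transport (trans x′y′ (sym xy)) in
        col z (h ⟨$⟩ʳ w) ,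
        (z , y , h ⟨$⟩ʳ w , zy ,
         trans (cong (λ u → col u (h ⟨$⟩ʳ w)) (sym hy′)) (trans (col-invariant Hh y′ w) y′w) , refl) ,
        (x , z , h ⟨$⟩ʳ w , xz , refl ,
         trans (cong (λ u → col u (h ⟨$⟩ʳ w)) (sym hx′)) (trans (col-invariant Hh x′ w) x′w))
    ; identityˡ = λ a → source a , source a , target a , refl , col-source-target a , col-source-target a
    ; identityʳ = λ a → source a , target a , target a , col-source-target a , refl , col-source-target a
    ; src-src = λ a → loop-at-source refl
    ; tgt-src = λ a → loop-at-target refl
    ; src-tgt = λ a → loop-at-source refl
    ; inv-comp = λ a → target a , source a , target a , refl , col-source-target a , refl
    ; comp-inv = λ a → source a , target a , source a , col-source-target a , refl , refl
    ; connected = λ a b → col (target a) (source b) , loop-at-source refl , loop-at-target refl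
    }

  adj-product : ∀ a b x y → (adj col a · adj col b) x y ≡ χ (triangle? a b (col x y))
  adj-product a b x y = begin
    ∑ (λ z → χ (col x z ≟ a) * χ (col z y ≟ b)) ≡⟨ ∑-cong (λ z → χ-× (col x z ≟ a) (col z y ≟ b)) ⟩
    ∑ (λ z → χ (P? z))                          ≡⟨ ∑-χ-unique P? P-unique ⟩
    χ (any? P?)                                 ≡⟨ χ-cong through-x triangle-at-x (any? P?) (triangle? a b (col x y)) ⟩
    χ (triangle? a b (col x y))                 ∎
    where
      open ≡-Reasoning
      P : Fin n → Set
      P z = col x z ≡ a × col z y ≡ b
      P? : ∀ z → Dec (P z)
      P? z = (col x z ≟ a) ×-dec (col z y ≟ b)
      P-unique : ∀ {z z′} → P z → P z′ → z ≡ z′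
      P-unique (xz , _) (xz′ , _) = col-injectiveʳ (trans xz (sym xz′))
      through-x : ∃ P → Triangle a b (col x y)
      through-x (z , xz , zy) = x , z , y , xz , zy , refl
      triangle-at-x : Triangle a b (col x y) → ∃ P
      triangle-at-x (x′ , z′ , y′ , x′z′ , z′y′ , x′y′) =
        let (h , Hh , hx′ , hy′) = col-transport x′y′ in
        h ⟨$⟩ʳ z′ ,
        trans (cong (λ u → col u (h ⟨$⟩ʳ z′)) (sym hx′)) (trans (col-invariant Hh x′ z′) x′z′) ,
        trans (cong (col (h ⟨$⟩ʳ z′)) (sym hy′)) (trans (col-invariant Hh z′ y′) z′y′)

  open GroupoidProperties colourGroupoid using (Hom; Anti; JordanMap)

  module _ (φ : Permutation′ m) where
    private
      f : Fin m → Fin m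
      f = φ ⟨$⟩ʳ_
      K : Fin m → Fin m → Fin m → ℕ
      K a b c = χ (triangle? a b c)

    algAut⇔ : IsAlgAut col φ ⇔ (∀ a b c → K a b c ≡ K (f a) (f b) (f c))
    algAut⇔ = transports⇔ φ K (λ a b → K (f a) (f b)) adj-product (λ a b → adj-product (f a) (f b))

    algAntiAut⇔ : IsAlgAntiAut col φ ⇔ (∀ a b c → K a b c ≡ K (f b) (f a) (f c))
    algAntiAut⇔ = transports⇔ φ K (λ a b → K (f b) (f a)) adj-product (λ a b → adj-product (f b) (f a))

    jordanAut⇔ : IsJordanAut col φ ⇔ JordanMap f
    jordanAut⇔ = transports⇔ φ (λ a b c → K a b c + K b a c) (λ a b c → K (f a) (f b) c + K (f b) (f a) c)
                              (λ a b x y → cong₂ _+_ (adj-product a b x y) (adj-product b a x y))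
                              (λ a b x y → cong₂ _+_ (adj-product (f a) (f b) x y) (adj-product (f b) (f a) x y))

    jordanAut⇒tAut : InJAut col φ → InTAut col φ
    jordanAut⇒tAut jφ =
      Sum.map (Equivalence.from algAut⇔ ∘ hom-coefficients) (Equivalence.from algAntiAut⇔ ∘ anti-coefficients)
              (jordan⇒hom⊎anti colourGroupoid φ (Equivalence.to jordanAut⇔ jφ))
      where
        hom-coefficients : Hom f → ∀ a b c → K a b c ≡ K (f a) (f b) (f c)
        hom-coefficients h a b c =
          χ-cong (Equivalence.to (h a b c)) (Equivalence.from (h a b c)) (triangle? a b c) (triangle? (f a) (f b) (f c))
        anti-coefficients : Anti f → ∀ a b c → K a b c ≡ K (f b) (f a) (f c)
        anti-coefficients h a b c =
          χ-cong (Equivalence.to (h a b c)) (Equivalence.from (h a b c)) (triangle? a b c) (triangle? (f b) (f a) (f c))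

    tAut⇒jordanAut : InTAut col φ → InJAut col φ
    tAut⇒jordanAut (inj₁ aut) = Equivalence.from jordanAut⇔ λ a b c →
      let N = Equivalence.to algAut⇔ aut in cong₂ _+_ (N a b c) (N b a c)
    tAut⇒jordanAut (inj₂ anti) = Equivalence.from jordanAut⇔ λ a b c →
      let N = Equivalence.to algAntiAut⇔ anti in trans (cong₂ _+_ (N a b c) (N b a c)) (+-comm (K (f b) (f a) (f c)) _)

proposition4p3 : ∀ {n : ℕ} (H : Permutation′ n → Set) → IsSubgroup H → Semiregular H →
    ∀ {m : ℕ} (col : Fin n → Fin n → Fin m) → IsTwoOrbitColouring H col →
      -- (a)
      (∀ {n₁ : ℕ} (ι : Fin n₁ → Fin n) → IsOrbitEmbedding H ι →
       ∀ {m₁ : ℕ} (col₁ : Fin n₁ → Fin n₁ → Fin m₁) → IsTwoOrbitColouringOn H ι col₁ →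
       ∀ {k : ℕ} (orb : Fin n → Fin k) → IsOrbitCount H orb →
         CombIso col (col₁ ⊗ discrete k))
      ×
      -- (b)
      (∀ (φ : Permutation′ m) → (InJAut col φ → InTAut col φ) × (InTAut col φ → InJAut col φ))
proposition4p3 H sg sr col colH =
  (λ ι ιH col₁ col₁H orb orbH → orbit-decomposition sg sr colH ιH col₁H orbH) ,
  (λ φ → jordanAut⇒tAut φ , tAut⇒jordanAut φ)
  where
    open TwoOrbitColouring sg sr colH
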